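{- Let $w$ be a word on the alphabet $\{a,b,c\}$ such that the tree-growing map $\varphi_w(M^0_\bullet)$ is well defined (i.e. every application of $\varphi_c$ in its computation satisfies the defining condition of $\varphi_c$). Then the endpoint of every leg of $\varphi_w(M^0_\bullet)$ is an ancestor of the head-vertex (with respect to its distinguished spanning tree and its root-vertex).
   Context: Maps: a planar map is a connected planar graph (loops, multiple edges allowed) embedded in the sphere up to orientation-preserving homeomorphism; edges consist of two half-edges each incident to one endpoint. A rooted map has a distinguished half-edge (the root), whose endpoint is the root-vertex. A growing map is a rooted map together with some legs (half-edges not belonging to a complete edge), one leg being distinguished as the head, all legs lying in one face called the head-face; the endpoint of the head is the head-vertex; the root may itself be a leg. A tree-growing map $M_T$ is a growing map with a distinguished spanning tree $T$. $u$ is an ancestor of $v$ if $u$ lies on the $T$-path from the root-vertex to $v$ (every vertex is an ancestor of itself); $u,v$ are comparable if one is an ancestor of the other. The tour of the head-face follows its border counterclockwise starting from the head, ordering the legs other than the head; this gives the first and last legs. Operations: $M^0_\bullet$ is the tree-growing map with one vertex and two legs (the root and the head), tree = that vertex. $\varphi_a(M_T)$ (resp. $\varphi_b$) replaces the head by a complete edge $e$ from the head-vertex to a new vertex $v$ carrying the new head and one further leg immediately at the left (resp. right) of the new head; tree becomes $T\cup\{e,v\}$. $\varphi_c(M_T)$ is defined only if the first and last legs exist and have distinct comparable endpoints; naming them $s,t$ with endpoint of $s$ an ancestor of endpoint of $t$, glue the head with $s$ into an edge and make $t$ the new head; $T$ unchanged. For $w=a_1\cdots a_m$, $\varphi_w=\varphi_{a_1}\circ\cdots\circ\varphi_{a_m}$.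 -}

module Defs where

open import Data.Nat using (ℕ; zero; suc; _+_; _<_; _≡ᵇ_)
open import Data.Bool using (Bool; true; false; if_then_else_)
open import Data.List using (List; []; _∷_; last)
import Data.List as L
open import Data.List.Membership.Propositional using (_∈_; _∉_)
open import Data.Maybe using (Maybe; just; nothing)
open import Data.Product using (Σ; ∃; _×_; _,_)
open import Relation.Binary.PropositionalEquality using (_≡_; _≢_)

-- Combinatorial encoding of (tree-)growing maps by rotation systems.
--
-- Half-edges are the natural numbers 0 .. nH-1.
--   cw h    : the next half-edge CLOCKWISE around the endpoint of h
--             (so cw⁻¹ is the counterclockwise successor).
--   α h     : the other half of the edge containing h;  α h ≡ h  iff  h is a leg.
--   vert h  : the endpoint (vertex label) of h; vertex labels are < nV.
--   inT h   : h belongs to an edge of the distinguished spanning tree T.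
--   root    : the root half-edge;  head : the head (a leg).
-- Values of cw, α, vert, inT on numbers ≥ nH are irrelevant junk.

record TGMap : Set where
  field
    nH   : ℕ
    nV   : ℕ
    cw   : ℕ → ℕ
    α    : ℕ → ℕ
    vert : ℕ → ℕ
    inT  : ℕ → Bool
    root : ℕ
    head : ℕ

open TGMap public

upd : {A : Set} → (ℕ → A) → ℕ → A → ℕ → A
upd f x y z = if z ≡ᵇ x then y else f z

rootVertex : TGMap → ℕ
rootVertex M = vert M (root M)

headVertex : TGMap → ℕ
headVertex M = vert M (head M)

IsLeg : TGMap → ℕ → Set
IsLeg M h = (h < nH M) × (α M h ≡ h)

-- Ancestry in the spanning tree T.
-- TPath M v vs : vs (reversed) is the vertex sequence of a simple path
-- in T from the root-vertex to v.

data TPath (M : TGMap) : ℕ → List ℕ → Set where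
  start : TPath M (rootVertex M) (rootVertex M ∷ [])
  step  : ∀ {u vs} h → TPath M u vs → h < nH M → inT M h ≡ true →
          vert M h ≡ u → vert M (α M h) ∉ vs →
          TPath M (vert M (α M h)) (vert M (α M h) ∷ vs)

Ancestor : TGMap → ℕ → ℕ → Set
Ancestor M u v = Σ (List ℕ) λ vs → TPath M v vs × (u ∈ vs)

-- Tour of the head-face: follow its border counterclockwise (face on the
-- left), i.e. iterate  h ↦ cw (α h)  starting from the head, listing the
-- legs met before returning to the head (the head itself excluded).

faceStep : TGMap → ℕ → ℕ
faceStep M h = cw M (α M h)

tourFrom : TGMap → ℕ → ℕ → List ℕ
tourFrom M zero    x = []
tourFrom M (suc k) x =
  if x ≡ᵇ head M then []
  else (if α M x ≡ᵇ x then x ∷ tourFrom M k (faceStep M x)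
        else tourFrom M k (faceStep M x))

tour : TGMap → List ℕ
tour M = tourFrom M (nH M) (faceStep M (head M))

firstLeg : TGMap → Maybe ℕ
firstLeg M = L.head (tour M)


lastLeg : TGMap → Maybe ℕ
lastLeg M = last (tour M)

M0 : TGMap
M0 = record
  { nH = 2 ; nV = 1
  ; cw = λ h → if h ≡ᵇ 0 then 1 else 0
  ; α = λ h → h
  ; vert = λ _ → 0
  ; inT = λ _ → false
  ; root = 0 ; head = 1 }

-- common part of φa / φb: head h becomes a complete edge {h, e'} with
-- e' = nH a new half-edge at the new vertex v = nV, which also carries
-- the new head h' = nH+1 and a new leg l = nH+2.  The argument cwv gives
-- the clockwise rotation at v.
grow : TGMap → (ℕ → ℕ) → TGMap
grow M cwv = record
  { nH = suc (suc (suc (nH M)))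
  ; nV = suc (nV M)
  ; cw = λ z → if z ≡ᵇ e' then cwv z else if z ≡ᵇ h' then cwv z
               else if z ≡ᵇ l then cwv z else cw M z
  ; α = upd (upd (upd (upd (α M) h e') e' h) h' h') l l
  ; vert = upd (upd (upd (vert M) e' (nV M)) h' (nV M)) l (nV M)
  ; inT = upd (upd (inT M) h true) e' true
  ; root = root M
  ; head = h' }
  where
  h  = head M
  e' = nH M
  h' = suc (nH M)
  l  = suc (suc (nH M))

-- φa: the new leg l is immediately at the LEFT of the new head, i.e. it is
-- the counterclockwise successor of h' :  clockwise order e' → l → h' → e'.
φa : TGMap → TGMap
φa M = grow M (upd (upd (upd (λ z → z) e' l) l h') h' e')
  where
  e' = nH M
  h' = suc (nH M)
  l  = suc (suc (nH M))

-- φb: l immediately at the RIGHT of h' (clockwise successor of h'):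
-- clockwise order e' → h' → l → e'.
φb : TGMap → TGMap
φb M = grow M (upd (upd (upd (λ z → z) e' h') h' l) l e')
  where
  e' = nH M
  h' = suc (nH M)
  l  = suc (suc (nH M))

glue : TGMap → ℕ → ℕ → TGMap
glue M s t = record M
  { α = upd (upd (α M) (head M) s) s (head M)
  ; head = t }

data Letter : Set where
  a b c : Letter

data Step : Letter → TGMap → TGMap → Set where
  stepA : ∀ M → Step a M (φa M)
  stepB : ∀ M → Step b M (φb M)
  stepC₁ : ∀ M s₀ t₀ → firstLeg M ≡ just s₀ → lastLeg M ≡ just t₀ →
           vert M s₀ ≢ vert M t₀ → Ancestor M (vert M s₀) (vert M t₀) →
           Step c M (glue M s₀ t₀)
  stepC₂ : ∀ M s₀ t₀ → firstLeg M ≡ just s₀ → lastLeg M ≡ just t₀ →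
           vert M s₀ ≢ vert M t₀ → Ancestor M (vert M t₀) (vert M s₀) →
           Step c M (glue M t₀ s₀)

-- Phi w M : φ_w(M⁰•) is well defined and equals M, where
-- φ_{a₁⋯aₘ} = φ_{a₁} ∘ ⋯ ∘ φ_{aₘ} (the last letter is applied first).
data Phi : List Letter → TGMap → Set where
  nil  : Phi [] M0
  cons : ∀ {x w M M'} → Phi w M → Step x M M' → Phi (x ∷ w) M'

{-# OPTIONS --safe #-}
-- Along a well-defined computation of φ_w(M⁰•) we keep an invariant of the head-face: going once
-- around it from the head meets every other leg, and the endpoints of these legs, in tour order,
-- form a valley in T (each is an ancestor either of all leg endpoints before it or of all those
-- after it), all of them being ancestors of the head-vertex.  φa and φb hang the new head-vertex
-- below the old one and put the new leg at one end of the tour, which preserves both properties.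
-- φc glues the head to one of the first and last legs s, t and makes the other the new head; the
-- new tour consists of the legs strictly between s and t, each of which is by the valley property
-- an ancestor of s or of t, hence (s and t being comparable) of the new head-vertex.  Transitivity
-- of ancestry rests on uniqueness of T-paths, certified by depth and parent functions for T.
module Submission where

open import Defs
open import Data.Bool using (true; false; if_then_else_; T)
open import Data.Empty using (⊥-elim)
open import Data.List using (List; []; _∷_; _++_; map; length; last; filter)
import Data.List as List
open import Data.List.Properties using (map-++; map-cong-local; ++-identityʳ; ++-assoc; filter-++; filter-none; filter-accept; filter-reject)
open import Data.List.Membership.Propositional using (_∈_; _∉_)
open import Data.List.Membership.Propositional.Properties using (∈-map⁺; ∈-filter⁺; ∈-++⁺ˡ; ∈-++⁺ʳ; ∈-++⁻)
open import Data.List.Relation.Binary.Subset.Propositional using (_⊆_)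
open import Data.List.Relation.Unary.All using (All; []; _∷_)
open import Data.List.Relation.Unary.All.Properties using (¬Any⇒All¬)
import Data.List.Relation.Unary.All as All
import Data.List.Relation.Unary.All.Properties as All
open import Data.List.Relation.Unary.Any using (here; there)
open import Data.Maybe using (just)
open import Data.Nat using (ℕ; zero; suc; _+_; _<_; _≤_; _≡ᵇ_; z≤n; s≤s)
open import Data.Nat.ListAction using (sum)
open import Data.Nat.ListAction.Properties using (sum-++)
open import Data.Nat.Properties
open import Data.Nat.Tactic.RingSolver using (solve-∀)
open import Data.Product using (Σ; _×_; _,_; proj₁; proj₂; map₁; uncurry)
open import Data.Sum using (_⊎_; inj₁; inj₂; [_,_]; swap)
open import Data.Unit using (⊤; tt)
open import Relation.Nullary using (Dec; yes; no)
open import Level using (0ℓ)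
open import Relation.Unary using (Pred; Decidable; ∁)
open import Relation.Binary.PropositionalEquality hiding ([_])
open import Function using (_∘_)

≡ᵇ-refl : ∀ n → (n ≡ᵇ n) ≡ true
≡ᵇ-refl zero    = refl
≡ᵇ-refl (suc n) = ≡ᵇ-refl n

≢⇒≡ᵇ-false : ∀ {m n} → m ≢ n → (m ≡ᵇ n) ≡ false
≢⇒≡ᵇ-false {m} {n} m≢n with m ≡ᵇ n in eq
... | false = refl
... | true  = ⊥-elim (m≢n (≡ᵇ⇒≡ m n (subst T (sym eq) tt)))

upd-≡ : {A : Set} (f : ℕ → A) → ∀ x y → upd f x y x ≡ y
upd-≡ f x y rewrite ≡ᵇ-refl x = refl

upd-≢ : {A : Set} (f : ℕ → A) → ∀ x y {z} → z ≢ x → upd f x y z ≡ f z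
upd-≢ f x y z≢x rewrite ≢⇒≡ᵇ-false z≢x = refl

-- Sub-multisets and distinct lists

module _ {A : Set} where

  weight : (A → ℕ) → List A → ℕ
  weight f xs = sum (map f xs)

  weight-++ : ∀ f xs ys → weight f (xs ++ ys) ≡ weight f xs + weight f ys
  weight-++ f xs ys rewrite map-++ f xs ys = sum-++ (map f xs) (map f ys)

  infix 4 _⊑_

  -- Sub-multisets, stated through all weightings at once so that each instance is a semiring identity.
  record _⊑_ (xs ys : List A) : Set where
    constructor by-weights
    field weight-≤ : ∀ f → weight f xs ≤ weight f ys
  open _⊑_ public

  ⊑-by-weights : ∀ {xs ys} rest → (∀ f → weight f xs + weight f rest ≡ weight f ys) → xs ⊑ ys
  ⊑-by-weights {xs} rest split = by-weights λ f → ≤-trans (m≤m+n (weight f xs) (weight f rest)) (≤-reflexive (split f))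

  length≡weight-one : ∀ xs → length xs ≡ weight (λ _ → 1) xs
  length≡weight-one []       = refl
  length≡weight-one (_ ∷ xs) = cong suc (length≡weight-one xs)

  ⊑-length : ∀ {xs ys} → xs ⊑ ys → length xs ≤ length ys
  ⊑-length {xs} {ys} xs⊑ys rewrite length≡weight-one xs | length≡weight-one ys = weight-≤ xs⊑ys (λ _ → 1)

multiplicity : ℕ → List ℕ → ℕ
multiplicity x = weight (λ y → if y ≡ᵇ x then 1 else 0)

record Distinct (xs : List ℕ) : Set where
  constructor by-multiplicity
  field multiplicity≤1 : ∀ x → multiplicity x xs ≤ 1
open Distinct public

∈⇒multiplicity-pos : ∀ {x xs} → x ∈ xs → 1 ≤ multiplicity x xs
∈⇒multiplicity-pos {x} (here refl) rewrite ≡ᵇ-refl x = s≤s z≤n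
∈⇒multiplicity-pos {x} {y ∷ ys} (there x∈ys) = ≤-trans (∈⇒multiplicity-pos x∈ys) (m≤n+m (multiplicity x ys) _)

multiplicity-pos⇒∈ : ∀ {x} xs → 1 ≤ multiplicity x xs → x ∈ xs
multiplicity-pos⇒∈ {x} (y ∷ ys) pos with y ≡ᵇ x in eq
... | true  = here (sym (≡ᵇ⇒≡ y x (subst T (sym eq) tt)))
... | false = there (multiplicity-pos⇒∈ ys pos)

∉⇒multiplicity-zero : ∀ {x xs} → x ∉ xs → multiplicity x xs ≡ 0
∉⇒multiplicity-zero {x} {[]}     _     = refl
∉⇒multiplicity-zero {x} {y ∷ ys} x∉y∷ys
  rewrite ≢⇒≡ᵇ-false {y} {x} (λ y≡x → x∉y∷ys (here (sym y≡x))) = ∉⇒multiplicity-zero (λ x∈ys → x∉y∷ys (there x∈ys))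

⊑-∈ : ∀ {xs ys x} → xs ⊑ ys → x ∈ xs → x ∈ ys
⊑-∈ {xs} {ys} {x} xs⊑ys x∈xs = multiplicity-pos⇒∈ ys (≤-trans (∈⇒multiplicity-pos x∈xs) (weight-≤ xs⊑ys _))

⊑-All : ∀ {P : ℕ → Set} {xs ys} → xs ⊑ ys → All P ys → All P xs
⊑-All xs⊑ys ps = All.tabulate (λ x∈xs → All.lookup ps (⊑-∈ xs⊑ys x∈xs))

⊑-Distinct : ∀ {xs ys} → xs ⊑ ys → Distinct ys → Distinct xs
⊑-Distinct xs⊑ys ys-distinct = by-multiplicity λ x → ≤-trans (weight-≤ xs⊑ys _) (multiplicity≤1 ys-distinct x)

Distinct-∷ : ∀ {x xs} → x ∉ xs → Distinct xs → Distinct (x ∷ xs)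
Distinct-∷ {x} {xs} x∉xs xs-distinct = by-multiplicity count
  where
  count : ∀ y → multiplicity y (x ∷ xs) ≤ 1
  count y with x ≡ᵇ y in eq
  ... | false = multiplicity≤1 xs-distinct y
  ... | true rewrite ≡ᵇ⇒≡ x y (subst T (sym eq) tt) | ∉⇒multiplicity-zero x∉xs = s≤s z≤n

∉⇒All≢ : ∀ {x : ℕ} {xs} → x ∉ xs → All (_≢ x) xs
∉⇒All≢ {xs = xs} x∉xs = All.map (_∘ sym) (¬Any⇒All¬ xs x∉xs)

Distinct-middle : ∀ as {x bs} → Distinct (as ++ x ∷ bs) → x ∉ as × x ∉ bs
Distinct-middle as {x} {bs} distinct =
  zero⇒∉ (n≤0⇒n≡0 (m+n≤o⇒m≤o _ (≤-pred bound))) , zero⇒∉ (n≤0⇒n≡0 (m+n≤o⇒n≤o _ (≤-pred bound)))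
  where
  split : multiplicity x (as ++ x ∷ bs) ≡ suc (multiplicity x as + multiplicity x bs)
  split rewrite weight-++ (λ y → if y ≡ᵇ x then 1 else 0) as (x ∷ bs) | ≡ᵇ-refl x = +-suc _ _
  bound : suc (multiplicity x as + multiplicity x bs) ≤ 1
  bound = subst (_≤ 1) split (multiplicity≤1 distinct x)
  zero⇒∉ : ∀ {ys} → multiplicity x ys ≡ 0 → x ∉ ys
  zero⇒∉ none x∈ys = 1+n≰n (subst (1 ≤_) none (∈⇒multiplicity-pos x∈ys))

-- Face walks and the tour

data FaceWalk (M : TGMap) : ℕ → List ℕ → ℕ → Set where
  reach : ∀ {x y} → faceStep M x ≡ y → FaceWalk M x [] y
  visit : ∀ {x z zs y} → faceStep M x ≡ z → FaceWalk M z zs y → FaceWalk M x (z ∷ zs) y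

FaceWalk-++ : ∀ {M x as y bs z} → FaceWalk M x as y → FaceWalk M y bs z → FaceWalk M x (as ++ y ∷ bs) z
FaceWalk-++ (reach x→y)   w = visit x→y w
FaceWalk-++ (visit x→z w) w′ = visit x→z (FaceWalk-++ w w′)

FaceWalk-split : ∀ {M x} as {y bs z} → FaceWalk M x (as ++ y ∷ bs) z → FaceWalk M x as y × FaceWalk M y bs z
FaceWalk-split []       (visit x→y w) = reach x→y , w
FaceWalk-split (_ ∷ as) (visit x→a w) = map₁ (visit x→a) (FaceWalk-split as w)

FaceWalk-transport : ∀ {M M′ x x′ bs y} → faceStep M′ x′ ≡ faceStep M x →
                     All (λ b → faceStep M′ b ≡ faceStep M b) bs → FaceWalk M x bs y → FaceWalk M′ x′ bs y
FaceWalk-transport same []         (reach x→y)   = reach (trans same x→y)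
FaceWalk-transport same (same′ ∷ ps) (visit x→z w) = visit (trans same x→z) (FaceWalk-transport same′ ps w)

isLeg? : (M : TGMap) → Decidable (λ z → α M z ≡ z)
isLeg? M z = α M z ≟ z

legs : TGMap → List ℕ → List ℕ
legs M = filter (isLeg? M)

legVertices : TGMap → List ℕ → List ℕ
legVertices M zs = map (vert M) (legs M zs)

tourFrom-legs : ∀ {M x bs} k → FaceWalk M x bs (head M) → All (_≢ head M) bs →
                length bs < k → tourFrom M k (faceStep M x) ≡ legs M bs
tourFrom-legs {M} (suc k) (reach x→h) _ _ rewrite x→h | ≡ᵇ-refl (head M) = refl
tourFrom-legs {M} (suc k) (visit {z = z} x→z w) (z≢h ∷ ps) (s≤s len<k)
  rewrite x→z | ≢⇒≡ᵇ-false z≢h | tourFrom-legs k w ps len<k with α M z ≡ᵇ z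
... | true  = refl
... | false = refl

legs-cong : ∀ {M M′} xs → All (λ z → α M′ z ≡ α M z) xs → legs M′ xs ≡ legs M xs
legs-cong         []       []             = refl
legs-cong {M} {M′} (x ∷ xs) (same ∷ sames) = by-leg (α M x ≟ x)
  where
  by-leg : Dec (α M x ≡ x) → legs M′ (x ∷ xs) ≡ legs M (x ∷ xs)
  by-leg (yes leg) = begin
    legs M′ (x ∷ xs) ≡⟨ filter-accept (isLeg? M′) {xs = xs} (trans same leg) ⟩
    x ∷ legs M′ xs   ≡⟨ cong (x List.∷_) (legs-cong {M} {M′} xs sames) ⟩
    x ∷ legs M xs    ≡⟨ filter-accept (isLeg? M) {xs = xs} leg ⟨
    legs M (x ∷ xs)  ∎
    where open ≡-Reasoning
  by-leg (no ¬leg) = begin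
    legs M′ (x ∷ xs) ≡⟨ filter-reject (isLeg? M′) {xs = xs} (¬leg ∘ trans (sym same)) ⟩
    legs M′ xs       ≡⟨ legs-cong {M} {M′} xs sames ⟩
    legs M xs        ≡⟨ filter-reject (isLeg? M) {xs = xs} ¬leg ⟨
    legs M (x ∷ xs)  ∎
    where open ≡-Reasoning

last-∷ : ∀ {A : Set} {x : A} {ys t} → last (x ∷ ys) ≡ just t → (x ≡ t) ⊎ (last ys ≡ just t)
last-∷ {ys = []}    refl   = inj₁ refl
last-∷ {ys = _ ∷ _} last≡t = inj₂ last≡t

module _ {A : Set} {P : Pred A 0ℓ} (P? : Decidable P) where

  head-filter-split : ∀ xs {s} → List.head (filter P? xs) ≡ just s →
                      Σ (List A) λ pre → Σ (List A) λ rest → xs ≡ pre ++ s ∷ rest × All (∁ P) pre × P s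
  head-filter-split (x ∷ xs) first with P? x
  ... | yes px with refl ← first = [] , xs , refl , [] , px
  ... | no ¬px with head-filter-split xs first
  ...   | pre , rest , refl , none , ps = x ∷ pre , rest , refl , ¬px ∷ none , ps

  filter≡[] : ∀ xs → filter P? xs ≡ [] → All (∁ P) xs
  filter≡[] []       _     = []
  filter≡[] (x ∷ xs) empty with P? x
  ... | no ¬px = ¬px ∷ filter≡[] xs empty

  last-filter-split : ∀ xs {t} → last (filter P? xs) ≡ just t →
                      Σ (List A) λ mid → Σ (List A) λ post → xs ≡ mid ++ t ∷ post × All (∁ P) post × P t
  last-filter-split (x ∷ xs) final with P? x
  ... | no ¬px with last-filter-split xs final
  ...   | mid , post , refl , none , pt = x ∷ mid , post , refl , none , pt
  last-filter-split (x ∷ xs) final | yes px with filter P? xs in eq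
  ...   | []    with refl ← final = [] , xs , refl , filter≡[] xs eq , px
  ...   | _ ∷ _ with last-filter-split xs (trans (cong last eq) final)
  ...     | mid , post , refl , none , pt = x ∷ mid , post , refl , none , pt

  record FirstLastSplit (xs : List A) (s t : A) : Set where
    field
      pre mid post : List A
      shape        : xs ≡ pre ++ s ∷ mid ++ t ∷ post
      pre-none     : All (∁ P) pre
      post-none    : All (∁ P) post
      first        : P s
      final        : P t

  first-last-split : ∀ xs {s t} → List.head (filter P? xs) ≡ just s → last (filter P? xs) ≡ just t → s ≢ t →
                     FirstLastSplit xs s t
  first-last-split xs {s} {t} first final s≢t with head-filter-split xs first
  ... | pre , rest , refl , pre-none , ps with last-∷ {x = s} {ys = filter P? rest} (subst (λ ys → last ys ≡ just t) filter-shape final)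
    where
    filter-shape : filter P? (pre ++ s ∷ rest) ≡ s ∷ filter P? rest
    filter-shape rewrite filter-++ P? pre (s ∷ rest) | filter-none P? pre-none = filter-accept P? ps
  ...   | inj₁ s≡t    = ⊥-elim (s≢t s≡t)
  ...   | inj₂ final′ with last-filter-split rest final′
  ...     | mid , post , refl , post-none , pt = record
    { pre = pre ; mid = mid ; post = post ; shape = refl
    ; pre-none = pre-none ; post-none = post-none ; first = ps ; final = pt }

-- Valleys

module _ {A : Set} (R : A → A → Set) where

  -- ValleyFrom R left xs, with `left` the reversed part of the list before xs:
  -- every x of xs is R-related to everything on its left or to everything on its right.
  ValleyFrom : List A → List A → Set
  ValleyFrom left []       = ⊤
  ValleyFrom left (x ∷ xs) = (All (R x) left ⊎ All (R x) xs) × ValleyFrom (x ∷ left) xs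

  Valley : List A → Set
  Valley = ValleyFrom []

module _ {A : Set} {R : A → A → Set} where

  ValleyFrom-∷ʳ : ∀ left xs {y} → ValleyFrom R left xs → All (λ x → R x y) xs → ValleyFrom R left (xs ++ y ∷ [])
  ValleyFrom-∷ʳ left []       _                    []         = inj₂ [] , tt
  ValleyFrom-∷ʳ left (x ∷ xs) (inj₁ all-left , v)  (_ ∷ rs)   = inj₁ all-left , ValleyFrom-∷ʳ (x ∷ left) xs v rs
  ValleyFrom-∷ʳ left (x ∷ xs) (inj₂ all-right , v) (r ∷ rs)   =
    inj₂ (All.++⁺ all-right (r ∷ [])) , ValleyFrom-∷ʳ (x ∷ left) xs v rs

  ValleyFrom-insert : ∀ left₁ left₂ xs {y} → ValleyFrom R (left₁ ++ left₂) xs → All (λ x → R x y) xs →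
                      ValleyFrom R (left₁ ++ y ∷ left₂) xs
  ValleyFrom-insert left₁ left₂ []       _                    []       = tt
  ValleyFrom-insert left₁ left₂ (x ∷ xs) (inj₁ all-left , v)  (r ∷ rs) =
    inj₁ (All.++⁺ (All.++⁻ˡ left₁ all-left) (r ∷ All.++⁻ʳ left₁ all-left)) , ValleyFrom-insert (x ∷ left₁) left₂ xs v rs
  ValleyFrom-insert left₁ left₂ (x ∷ xs) (inj₂ all-right , v) (_ ∷ rs) =
    inj₂ all-right , ValleyFrom-insert (x ∷ left₁) left₂ xs v rs

  ValleyFrom-forget : ∀ left extra xs → ValleyFrom R (left ++ extra) xs → ValleyFrom R left xs
  ValleyFrom-forget left extra []       _                    = tt
  ValleyFrom-forget left extra (x ∷ xs) (inj₁ all-left , v)  =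
    inj₁ (All.++⁻ˡ left all-left) , ValleyFrom-forget (x ∷ left) extra xs v
  ValleyFrom-forget left extra (x ∷ xs) (inj₂ all-right , v) = inj₂ all-right , ValleyFrom-forget (x ∷ left) extra xs v

  ValleyFrom-init : ∀ left xs {t} → ValleyFrom R left (xs ++ t ∷ []) → ValleyFrom R left xs
  ValleyFrom-init left []       _                    = tt
  ValleyFrom-init left (x ∷ xs) (inj₁ all-left , v)  = inj₁ all-left , ValleyFrom-init (x ∷ left) xs v
  ValleyFrom-init left (x ∷ xs) (inj₂ all-right , v) = inj₂ (All.++⁻ˡ xs all-right) , ValleyFrom-init (x ∷ left) xs v

  ValleyFrom-between : ∀ left xs {s t} → ValleyFrom R left (xs ++ t ∷ []) → (∀ {u} → All (R u) left → R u s) →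
                       All (λ x → R x s ⊎ R x t) xs
  ValleyFrom-between left []       _           _      = []
  ValleyFrom-between left (x ∷ xs) {s} {t} (sides , v) to-s =
    [ inj₁ ∘ to-s , inj₂ ∘ All.head ∘ All.++⁻ʳ xs ] sides ∷ ValleyFrom-between (x ∷ left) xs v (to-s ∘ All.tail)

  ValleyFrom-map : ∀ {R′ : A → A → Set} → (∀ {x y} → R x y → R′ x y) → ∀ left xs → ValleyFrom R left xs → ValleyFrom R′ left xs
  ValleyFrom-map f left []       _                    = tt
  ValleyFrom-map f left (x ∷ xs) (inj₁ all-left , v)  = inj₁ (All.map f all-left) , ValleyFrom-map f (x ∷ left) xs v
  ValleyFrom-map f left (x ∷ xs) (inj₂ all-right , v) = inj₂ (All.map f all-right) , ValleyFrom-map f (x ∷ left) xs v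

  Valley-∷ : ∀ {y xs} → All (λ x → R x y) xs → Valley R xs → Valley R (y ∷ xs)
  Valley-∷ rs v = inj₁ [] , ValleyFrom-insert [] [] _ v rs

  Valley-∷ʳ : ∀ {xs y} → All (λ x → R x y) xs → Valley R xs → Valley R (xs ++ y ∷ [])
  Valley-∷ʳ rs v = ValleyFrom-∷ʳ [] _ v rs

  Valley-inner : ∀ {s xs t} → Valley R (s ∷ xs ++ t ∷ []) → Valley R xs
  Valley-inner {s} {xs} (_ , v) = ValleyFrom-forget [] (s ∷ []) xs (ValleyFrom-init (s ∷ []) xs v)

  Valley-between : ∀ {s xs t} → Valley R (s ∷ xs ++ t ∷ []) → All (λ x → R x s ⊎ R x t) xs
  Valley-between {s} {xs} (_ , v) = ValleyFrom-between (s ∷ []) xs v All.head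

  Valley-map : ∀ {R′ : A → A → Set} → (∀ {x y} → R x y → R′ x y) → ∀ {xs} → Valley R xs → Valley R′ xs
  Valley-map f = ValleyFrom-map f [] _

-- Ancestry in the spanning tree

lineage : (ℕ → ℕ) → ℕ → ℕ → List ℕ
lineage parent zero    v = v ∷ []
lineage parent (suc k) v = v ∷ lineage parent k (parent v)

TreeEdge : (depth parent : ℕ → ℕ) → ℕ → ℕ → Set
TreeEdge depth parent u w = (depth w ≡ suc (depth u) × parent w ≡ u) ⊎ (depth u ≡ suc (depth w) × parent u ≡ w)

TreeEdge-sym : ∀ {depth parent u w} → TreeEdge depth parent u w → TreeEdge depth parent w u
TreeEdge-sym = [ inj₂ , inj₁ ]

TreeEdge-transport : ∀ {depth parent depth′ parent′ u w} →
                     depth′ u ≡ depth u → depth′ w ≡ depth w → parent′ u ≡ parent u → parent′ w ≡ parent w →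
                     TreeEdge depth parent u w → TreeEdge depth′ parent′ u w
TreeEdge-transport du dw pu pw (inj₁ (deeper , up)) = inj₁ (trans dw (trans deeper (cong suc (sym du))) , trans pw up)
TreeEdge-transport du dw pu pw (inj₂ (higher , up)) = inj₂ (trans du (trans higher (cong suc (sym dw))) , trans pu up)

record Levelling (M : TGMap) : Set where
  field
    depth parent : ℕ → ℕ
    depth-root   : depth (rootVertex M) ≡ 0
    tree-edge    : ∀ z → inT M z ≡ true → TreeEdge depth parent (vert M z) (vert M (α M z))

TPath-endpoint : ∀ {M v vs} → TPath M v vs → v ∈ vs
TPath-endpoint start               = here refl
TPath-endpoint (step _ _ _ _ _ _) = here refl

-- A simple T-path never climbs a level (the parent is already on it), so it is the lineage of its endpoint.
TPath-lineage : ∀ {M} (L : Levelling M) {v vs} → TPath M v vs →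
                vs ≡ lineage (Levelling.parent L) (Levelling.depth L v) v
TPath-lineage L start rewrite Levelling.depth-root L = refl
TPath-lineage {M} L (step h p _ tree refl new) with Levelling.tree-edge L h tree | TPath-lineage L p
... | inj₁ (deeper , parent≡) | vs≡ rewrite deeper | parent≡ = cong (vert M (α M h) List.∷_) vs≡
... | inj₂ (higher , parent≡) | vs≡ rewrite higher | parent≡ =
  ⊥-elim (new (subst (vert M (α M h) ∈_) (sym vs≡) (there (lineage-head _))))
  where
  lineage-head : ∀ k {w} → w ∈ lineage (Levelling.parent L) k w
  lineage-head zero    = here refl
  lineage-head (suc k) = here refl

TPath-prefix : ∀ {M v vs y} → TPath M v vs → y ∈ vs → Σ (List ℕ) λ ws → TPath M y ws × ws ⊆ vs
TPath-prefix start                (here refl) = _ , start , λ y∈ → y∈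
TPath-prefix p@(step _ _ _ _ _ _) (here refl) = _ , p , λ y∈ → y∈
TPath-prefix (step _ p _ _ _ _)   (there y∈)  with TPath-prefix p y∈
... | ws , q , ws⊆vs = ws , q , there ∘ ws⊆vs

Ancestor-refl : ∀ {M v vs} → TPath M v vs → Ancestor M v v
Ancestor-refl p = _ , p , TPath-endpoint p

Ancestor-trans : ∀ {M} → Levelling M → ∀ {x y z} → Ancestor M x y → Ancestor M y z → Ancestor M x z
Ancestor-trans L (vs , p , x∈vs) (us , q , y∈us) with TPath-prefix q y∈us
... | ws , p′ , ws⊆us = us , q , ws⊆us (subst (_ ∈_) (trans (TPath-lineage L p) (sym (TPath-lineage L p′))) x∈vs)

TPath-bounded : ∀ {M} → root M < nH M → (∀ z → z < nH M → α M z < nH M) → (∀ z → z < nH M → vert M z < nV M) →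
                ∀ {v vs} → TPath M v vs → All (_< nV M) vs
TPath-bounded root< α< vert< start                 = vert< _ root< ∷ []
TPath-bounded root< α< vert< (step h p h< _ _ _) = vert< _ (α< h h<) ∷ TPath-bounded root< α< vert< p

record TreeEmbedding (M M′ : TGMap) : Set where
  field
    same-rootVertex : rootVertex M′ ≡ rootVertex M
    keeps-edge      : ∀ z → inT M z ≡ true →
                      inT M′ z ≡ true × z < nH M′ × vert M′ z ≡ vert M z × vert M′ (α M′ z) ≡ vert M (α M z)

TPath-embed : ∀ {M M′} → TreeEmbedding M M′ → ∀ {v vs} → TPath M v vs → TPath M′ v vs
TPath-embed {M′ = M′} E start = subst (λ r → TPath M′ r (r ∷ [])) (TreeEmbedding.same-rootVertex E) start
TPath-embed {M′ = M′} E (step {vs = vs} h p _ tree refl new) with TreeEmbedding.keeps-edge E h tree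
... | tree′ , h< , same-tail , same-head =
  subst (λ r → TPath M′ r (r ∷ vs)) same-head
        (step h (TPath-embed E p) h< tree′ same-tail (subst (_∉ vs) (sym same-head) new))

Ancestor-embed : ∀ {M M′} → TreeEmbedding M M′ → ∀ {u v} → Ancestor M u v → Ancestor M′ u v
Ancestor-embed E (vs , p , u∈vs) = vs , TPath-embed E p , u∈vs

-- The invariant

record Invariant (M : TGMap) : Set where
  field
    border             : List ℕ
    border-walk        : FaceWalk M (head M) border (head M)
    border-distinct    : Distinct (head M ∷ border)
    border-bounded     : All (_< nH M) (head M ∷ border)
    border-length      : length (head M ∷ border) ≤ nH M
    root-bounded       : root M < nH M
    α-bounded          : ∀ z → z < nH M → α M z < nH M
    vert-bounded       : ∀ z → z < nH M → vert M z < nV M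
    tree-halfEdge      : ∀ z → inT M z ≡ true → z < nH M × α M z ≢ z
    head-isLeg         : α M (head M) ≡ head M
    legs-on-border     : ∀ z → IsLeg M z → z ≢ head M → z ∈ border
    levelling          : Levelling M
    head-path          : Σ (List ℕ) (TPath M (headVertex M))
    legs-below-head    : All (λ u → Ancestor M u (headVertex M)) (legVertices M border)
    legVertices-valley : Valley (Ancestor M) (legVertices M border)

  head∉border : All (_≢ head M) border
  head∉border = ∉⇒All≢ (proj₂ (Distinct-middle [] border-distinct))

  tour≡legs : tour M ≡ legs M border
  tour≡legs = tourFrom-legs (nH M) border-walk head∉border border-length

  leg-below-head : ∀ z → IsLeg M z → Ancestor M (vert M z) (headVertex M)
  leg-below-head z z-leg with z ≟ head M
  ... | yes refl = Ancestor-refl (proj₂ head-path)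
  ... | no  z≢h  = All.lookup legs-below-head
                     (∈-map⁺ (vert M) (∈-filter⁺ (isLeg? M) (legs-on-border z z-leg z≢h) (proj₂ z-leg)))

invariant-M0 : Invariant M0
invariant-M0 = record
  { border             = 0 ∷ []
  ; border-walk        = visit refl (reach refl)
  ; border-distinct    = Distinct-∷ {1} {0 ∷ []} (λ { (here ()) }) (Distinct-∷ {0} {[]} (λ ()) (by-multiplicity λ _ → z≤n))
  ; border-bounded     = s≤s (s≤s z≤n) ∷ s≤s z≤n ∷ []
  ; border-length      = ≤-refl
  ; root-bounded       = s≤s z≤n
  ; α-bounded          = λ _ z< → z<
  ; vert-bounded       = λ _ _ → s≤s z≤n
  ; tree-halfEdge      = λ _ ()
  ; head-isLeg         = refl
  ; legs-on-border     = legs-on-border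
  ; levelling          = record { depth = λ _ → 0 ; parent = λ _ → 0 ; depth-root = refl ; tree-edge = λ _ () }
  ; head-path          = 0 ∷ [] , start
  ; legs-below-head    = (0 ∷ [] , start , here refl) ∷ []
  ; legVertices-valley = inj₂ [] , tt
  }
  where
  legs-on-border : ∀ z → IsLeg M0 z → z ≢ 1 → z ∈ 0 ∷ []
  legs-on-border 0             _                  _   = here refl
  legs-on-border 1             _                  1≢1 = ⊥-elim (1≢1 refl)
  legs-on-border (suc (suc z)) (s≤s (s≤s ()) , _) _

-- φa and φb

<-weaken₃ : ∀ {m n} → m < n → m < suc (suc (suc n))
<-weaken₃ = m≤n⇒m≤1+n ∘ m≤n⇒m≤1+n ∘ m≤n⇒m≤1+n

Distinct-∷-above : ∀ {k xs} → All (_< k) xs → Distinct xs → Distinct (k ∷ xs)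
Distinct-∷-above below = Distinct-∷ (λ k∈xs → <-irrefl refl (All.lookup below k∈xs))

module Grow {M : TGMap} (I : Invariant M) (cwv : ℕ → ℕ) where
  open Invariant I
  open Levelling levelling

  n = nH M
  h = head M
  e′ = n
  h′ = suc n
  l = suc (suc n)
  v = nV M
  M′ = grow M cwv

  h<n : h < n
  h<n = All.head border-bounded

  e′≢h′ : e′ ≢ h′
  e′≢h′ = <⇒≢ (n<1+n n)
  e′≢l : e′ ≢ l
  e′≢l = <⇒≢ (m≤n⇒m≤1+n (n<1+n n))
  h′≢l : h′ ≢ l
  h′≢l = <⇒≢ (n<1+n (suc n))

  data HalfEdge : ℕ → Set where
    old     : ∀ {z} → z < n → HalfEdge z
    edge    : HalfEdge e′
    newHead : HalfEdge h′
    newLeg  : HalfEdge l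

  halfEdge : ∀ z → z < nH M′ → HalfEdge z
  halfEdge z z< with z ≟ e′ | z ≟ h′ | z ≟ l
  ... | yes refl | _        | _        = edge
  ... | no _     | yes refl | _        = newHead
  ... | no _     | no _     | yes refl = newLeg
  ... | no ≢e′   | no ≢h′   | no ≢l    = old (≤∧≢⇒< (≤-pred (≤∧≢⇒< (≤-pred (≤∧≢⇒< (≤-pred z<) ≢l)) ≢h′)) ≢e′)

  private
    α₁ = upd (α M) h e′
    α₂ = upd α₁ e′ h
    α₃ = upd α₂ h′ h′
    vert₁ = upd (vert M) e′ v
    vert₂ = upd vert₁ h′ v
    inT₁ = upd (inT M) h true

  module _ {z} (z<n : z < n) where
    z≢e′ : z ≢ e′
    z≢e′ = <⇒≢ z<n
    z≢h′ : z ≢ h′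
    z≢h′ = <⇒≢ (m≤n⇒m≤1+n z<n)
    z≢l : z ≢ l
    z≢l = <⇒≢ (m≤n⇒m≤1+n (m≤n⇒m≤1+n z<n))

    cw-old : cw M′ z ≡ cw M z
    cw-old rewrite ≢⇒≡ᵇ-false z≢e′ | ≢⇒≡ᵇ-false z≢h′ | ≢⇒≡ᵇ-false z≢l = refl

    vert-old : vert M′ z ≡ vert M z
    vert-old = trans (upd-≢ vert₂ l v z≢l) (trans (upd-≢ vert₁ h′ v z≢h′) (upd-≢ (vert M) e′ v z≢e′))

    α-old≡α₁ : α M′ z ≡ α₁ z
    α-old≡α₁ = trans (upd-≢ α₃ l l z≢l) (trans (upd-≢ α₂ h′ h′ z≢h′) (upd-≢ α₁ e′ h z≢e′))

    α-old : z ≢ h → α M′ z ≡ α M z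
    α-old z≢h = trans α-old≡α₁ (upd-≢ (α M) h e′ z≢h)


  cw-e′ : cw M′ e′ ≡ cwv e′
  cw-e′ rewrite ≡ᵇ-refl n = refl
  cw-h′ : cw M′ h′ ≡ cwv h′
  cw-h′ rewrite ≢⇒≡ᵇ-false (e′≢h′ ∘ sym) | ≡ᵇ-refl n = refl
  cw-l : cw M′ l ≡ cwv l
  cw-l rewrite ≢⇒≡ᵇ-false (e′≢l ∘ sym) | ≢⇒≡ᵇ-false (h′≢l ∘ sym) | ≡ᵇ-refl n = refl

  α-h : α M′ h ≡ e′
  α-h = trans (α-old≡α₁ h<n) (upd-≡ (α M) h e′)
  α-e′ : α M′ e′ ≡ h
  α-e′ = trans (upd-≢ α₃ l l e′≢l) (trans (upd-≢ α₂ h′ h′ e′≢h′) (upd-≡ α₁ e′ h))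
  α-h′ : α M′ h′ ≡ h′
  α-h′ = trans (upd-≢ α₃ l l h′≢l) (upd-≡ α₂ h′ h′)
  α-l : α M′ l ≡ l
  α-l = upd-≡ α₃ l l

  vert-e′ : vert M′ e′ ≡ v
  vert-e′ = trans (upd-≢ vert₂ l v e′≢l) (trans (upd-≢ vert₁ h′ v e′≢h′) (upd-≡ (vert M) e′ v))
  vert-h′ : vert M′ h′ ≡ v
  vert-h′ = trans (upd-≢ vert₂ l v h′≢l) (upd-≡ vert₁ h′ v)
  vert-l : vert M′ l ≡ v
  vert-l = upd-≡ vert₂ l v

  inT-h : inT M′ h ≡ true
  inT-h = trans (upd-≢ inT₁ e′ true (z≢e′ h<n)) (upd-≡ (inT M) h true)
  inT-other : ∀ {z} → z ≢ h → z ≢ e′ → inT M′ z ≡ inT M z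
  inT-other z≢h z≢e′ = trans (upd-≢ inT₁ e′ true z≢e′) (upd-≢ (inT M) h true z≢h)

  faceStep-old : ∀ {z} → z < n → z ≢ h → faceStep M′ z ≡ faceStep M z
  faceStep-old {z} z<n z≢h rewrite α-old z<n z≢h = cw-old (α-bounded z z<n)
  faceStep-e′ : faceStep M′ e′ ≡ faceStep M h
  faceStep-e′ rewrite α-e′ | head-isLeg = cw-old h<n
  faceStep-h : faceStep M′ h ≡ cwv e′
  faceStep-h rewrite α-h = cw-e′
  faceStep-h′ : faceStep M′ h′ ≡ cwv h′
  faceStep-h′ rewrite α-h′ = cw-h′
  faceStep-l : faceStep M′ l ≡ cwv l
  faceStep-l rewrite α-l = cw-l

  border<n : All (_< n) border
  border<n = All.tail border-bounded

  walk-e′-to-h : FaceWalk M′ e′ border h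
  walk-e′-to-h = FaceWalk-transport faceStep-e′ (All.zipWith (uncurry faceStep-old) (border<n , head∉border)) border-walk

  grown : List ℕ
  grown = l ∷ h′ ∷ e′ ∷ h ∷ border

  grown-distinct : Distinct grown
  grown-distinct =
    Distinct-∷-above (n<1+n (suc n) ∷ m≤n⇒m≤1+n (n<1+n n) ∷ All.map (m≤n⇒m≤1+n ∘ m≤n⇒m≤1+n) border-bounded)
      (Distinct-∷-above (n<1+n n ∷ All.map m≤n⇒m≤1+n border-bounded)
        (Distinct-∷-above border-bounded border-distinct))

  grown-bounded : All (_< nH M′) grown
  grown-bounded = n<1+n l ∷ m≤n⇒m≤1+n (n<1+n h′) ∷ m≤n⇒m≤1+n (m≤n⇒m≤1+n (n<1+n n)) ∷ All.map <-weaken₃ border-bounded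

  grown-length : length grown ≤ nH M′
  grown-length = s≤s (s≤s (s≤s border-length))

  α-bounded′ : ∀ z → z < nH M′ → α M′ z < nH M′
  α-bounded′ z z< with halfEdge z z<
  ... | edge    = subst (_< nH M′) (sym α-e′) (<-weaken₃ h<n)
  ... | newHead = subst (_< nH M′) (sym α-h′) z<
  ... | newLeg  = subst (_< nH M′) (sym α-l) z<
  ... | old z<n with z ≟ h
  ...   | yes refl = subst (_< nH M′) (sym α-h) (m≤n⇒m≤1+n (m≤n⇒m≤1+n (n<1+n n)))
  ...   | no z≢h   = subst (_< nH M′) (sym (α-old z<n z≢h)) (<-weaken₃ (α-bounded z z<n))

  vert-bounded′ : ∀ z → z < nH M′ → vert M′ z < nV M′
  vert-bounded′ z z< with halfEdge z z<
  ... | edge    = subst (_< suc v) (sym vert-e′) (n<1+n v)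
  ... | newHead = subst (_< suc v) (sym vert-h′) (n<1+n v)
  ... | newLeg  = subst (_< suc v) (sym vert-l) (n<1+n v)
  ... | old z<n = subst (_< suc v) (sym (vert-old z<n)) (m≤n⇒m≤1+n (vert-bounded z z<n))

  tree-halfEdge′ : ∀ z → inT M′ z ≡ true → z < nH M′ × α M′ z ≢ z
  tree-halfEdge′ z tree with z ≟ h | z ≟ e′
  ... | yes refl | _        = <-weaken₃ h<n , subst (_≢ h) (sym α-h) (z≢e′ h<n ∘ sym)
  ... | no _     | yes refl = m≤n⇒m≤1+n (m≤n⇒m≤1+n (n<1+n n)) , subst (_≢ e′) (sym α-e′) (z≢e′ h<n)
  ... | no z≢h   | no z≢e′ with tree-halfEdge z (trans (sym (inT-other z≢h z≢e′)) tree)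
  ...   | z<n , not-leg = <-weaken₃ z<n , subst (_≢ z) (sym (α-old z<n z≢h)) not-leg

  leg-new-or-on-border : ∀ z → IsLeg M′ z → z ≢ h′ → z ≡ l ⊎ z ∈ border
  leg-new-or-on-border z (z< , z-leg) z≢h′ with halfEdge z z<
  ... | edge    = ⊥-elim (<⇒≢ h<n (trans (sym α-e′) z-leg))
  ... | newHead = ⊥-elim (z≢h′ refl)
  ... | newLeg  = inj₁ refl
  ... | old z<n with z ≟ h
  ...   | yes refl = ⊥-elim (<⇒≢ h<n (sym (trans (sym α-h) z-leg)))
  ...   | no z≢h   = inj₂ (legs-on-border z (z<n , trans (sym (α-old z<n z≢h)) z-leg) z≢h)

  hv<v : vert M h < v
  hv<v = vert-bounded h h<n

  depth′ parent′ : ℕ → ℕ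
  depth′ = upd depth v (suc (depth (vert M h)))
  parent′ = upd parent v (vert M h)

  module _ {u} (u<v : u < v) where
    depth-old : depth′ u ≡ depth u
    depth-old = upd-≢ depth v _ (<⇒≢ u<v)
    parent-old : parent′ u ≡ parent u
    parent-old = upd-≢ parent v _ (<⇒≢ u<v)

  new-vertex-edge : TreeEdge depth′ parent′ (vert M h) v
  new-vertex-edge = inj₁ (trans (upd-≡ depth v _) (cong suc (sym (depth-old hv<v))) , upd-≡ parent v _)

  tree≢head : ∀ {z} → inT M z ≡ true → z ≢ h
  tree≢head tree refl = proj₂ (tree-halfEdge h tree) head-isLeg

  old-tree-edge : ∀ {z} → inT M z ≡ true → TreeEdge depth′ parent′ (vert M′ z) (vert M′ (α M′ z))
  old-tree-edge {z} tree with tree-halfEdge z tree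
  ... | z<n , _ rewrite α-old z<n (tree≢head tree) | vert-old z<n | vert-old (α-bounded z z<n) =
    TreeEdge-transport {depth} {parent} {depth′} {parent′} (depth-old u<v) (depth-old w<v) (parent-old u<v) (parent-old w<v) (tree-edge z tree)
    where
    u<v = vert-bounded z z<n
    w<v = vert-bounded _ (α-bounded z z<n)

  levelling′ : Levelling M′
  levelling′ = record { depth = depth′ ; parent = parent′ ; depth-root = depth-root′ ; tree-edge = tree-edge′ }
    where
    depth-root′ : depth′ (vert M′ (root M)) ≡ 0
    depth-root′ rewrite vert-old root-bounded = trans (depth-old (vert-bounded _ root-bounded)) depth-root
    tree-edge′ : ∀ z → inT M′ z ≡ true → TreeEdge depth′ parent′ (vert M′ z) (vert M′ (α M′ z))
    tree-edge′ z tree with z ≟ h | z ≟ e′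
    ... | yes refl | _        rewrite α-h | vert-e′ | vert-old h<n = new-vertex-edge
    ... | no _     | yes refl rewrite α-e′ | vert-e′ | vert-old h<n = TreeEdge-sym {depth′} {parent′} new-vertex-edge
    ... | no z≢h   | no z≢e′  = old-tree-edge (trans (sym (inT-other z≢h z≢e′)) tree)

  embedding : TreeEmbedding M M′
  embedding = record { same-rootVertex = vert-old root-bounded ; keeps-edge = keeps-edge }
    where
    keeps-edge : ∀ z → inT M z ≡ true →
                 inT M′ z ≡ true × z < nH M′ × vert M′ z ≡ vert M z × vert M′ (α M′ z) ≡ vert M (α M z)
    keeps-edge z tree with tree-halfEdge z tree
    ... | z<n , _ = trans (inT-other (tree≢head tree) (z≢e′ z<n)) tree , <-weaken₃ z<n , vert-old z<n
                  , trans (cong (vert M′) (α-old z<n (tree≢head tree))) (vert-old (α-bounded z z<n))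

  head-path′ : TPath M′ (vert M′ h′) (v ∷ proj₁ head-path)
  head-path′ = subst (λ r → TPath M′ r (v ∷ proj₁ head-path)) (sym vert-h′)
    (subst (λ r → TPath M′ r (r ∷ proj₁ head-path)) (trans (cong (vert M′) α-h) vert-e′)
      (step h (TPath-embed embedding (proj₂ head-path)) (<-weaken₃ h<n) inT-h (vert-old h<n) v∉path))
    where
    v∉path : vert M′ (α M′ h) ∉ proj₁ head-path
    v∉path rewrite α-h | vert-e′ = λ v∈ → <-irrefl refl (All.lookup (TPath-bounded root-bounded α-bounded vert-bounded (proj₂ head-path)) v∈)

  below-new-head : ∀ {u} → Ancestor M u (headVertex M) → Ancestor M′ u (vert M′ h′)
  below-new-head u≤hv = Ancestor-trans levelling′ (Ancestor-embed embedding u≤hv) (_ , head-path′ , there (TPath-endpoint (proj₂ head-path)))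

  new-vertex-below-new-head : Ancestor M′ (vert M′ h′) (vert M′ h′)
  new-vertex-below-new-head = Ancestor-refl head-path′

  legVertices-border : legVertices M′ border ≡ legVertices M border
  legVertices-border rewrite legs-cong {M} {M′} border (All.zipWith (uncurry α-old) (border<n , head∉border)) =
    map-cong-local (All.filter⁺ (isLeg? M) (All.map vert-old border<n))

  old-legs-below-new-head : All (λ u → Ancestor M′ u (vert M′ h′)) (legVertices M border)
  old-legs-below-new-head = All.map below-new-head legs-below-head

  old-legs-valley : Valley (Ancestor M′) (legVertices M border)
  old-legs-valley = Valley-map (Ancestor-embed embedding) legVertices-valley

  invariant : (new-border : List ℕ) → FaceWalk M′ h′ new-border h′ → h′ ∷ new-border ⊑ grown →
              l ∈ new-border → border ⊆ new-border →
              All (λ u → Ancestor M′ u (headVertex M′)) (legVertices M′ new-border) →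
              Valley (Ancestor M′) (legVertices M′ new-border) → Invariant M′
  invariant new-border walk ⊑grown l∈ border⊆ below valley = record
    { border             = new-border
    ; border-walk        = walk
    ; border-distinct    = ⊑-Distinct ⊑grown grown-distinct
    ; border-bounded     = ⊑-All ⊑grown grown-bounded
    ; border-length      = ≤-trans (⊑-length ⊑grown) grown-length
    ; root-bounded       = <-weaken₃ root-bounded
    ; α-bounded          = α-bounded′
    ; vert-bounded       = vert-bounded′
    ; tree-halfEdge      = tree-halfEdge′
    ; head-isLeg         = α-h′
    ; legs-on-border     = λ z z-leg z≢h′ → [ (λ { refl → l∈ }) , border⊆ ] (leg-new-or-on-border z z-leg z≢h′)
    ; levelling          = levelling′
    ; head-path          = _ , head-path′
    ; legs-below-head    = below
    ; legVertices-valley = valley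
    }

  legs-e′∷ : ∀ zs → legs M′ (e′ ∷ zs) ≡ legs M′ zs
  legs-e′∷ zs = filter-reject (isLeg? M′) {xs = zs} (λ e′-leg → <⇒≢ h<n (trans (sym α-e′) e′-leg))

  legs-h∷ : ∀ zs → legs M′ (h ∷ zs) ≡ legs M′ zs
  legs-h∷ zs = filter-reject (isLeg? M′) {xs = zs} (λ h-leg → <⇒≢ h<n (sym (trans (sym α-h) h-leg)))

  legs-l∷ : ∀ zs → legs M′ (l ∷ zs) ≡ l ∷ legs M′ zs
  legs-l∷ zs = filter-accept (isLeg? M′) {xs = zs} α-l

  vert-l≡headVertex : vert M′ l ≡ vert M′ h′
  vert-l≡headVertex = trans vert-l (sym vert-h′)

invariant-φa : ∀ {M} → Invariant M → Invariant (φa M)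
invariant-φa {M} I =
  invariant new-border walk ⊑grown (there (∈-++⁺ʳ border (there (here refl)))) (there ∘ ∈-++⁺ˡ)
    (subst (All (λ u → Ancestor (φa M) u (headVertex (φa M)))) (sym legVertices-new)
           (All.++⁺ old-legs-below-new-head (new-vertex-below-new-head ∷ [])))
    (subst (Valley (Ancestor (φa M))) (sym legVertices-new) (Valley-∷ʳ old-legs-below-new-head old-legs-valley))
  where
  open Invariant I using (border)
  cw₁ = upd (λ z → z) (nH M) (suc (suc (nH M)))
  cw₂ = upd cw₁ (suc (suc (nH M))) (suc (nH M))
  cwv = upd cw₂ (suc (nH M)) (nH M)
  open Grow I cwv

  cwv-h′ : cwv h′ ≡ e′
  cwv-h′ = upd-≡ cw₂ h′ e′
  cwv-e′ : cwv e′ ≡ l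
  cwv-e′ = trans (upd-≢ cw₂ h′ e′ e′≢h′) (trans (upd-≢ cw₁ l h′ e′≢l) (upd-≡ (λ z → z) e′ l))
  cwv-l : cwv l ≡ h′
  cwv-l = trans (upd-≢ cw₂ h′ e′ (h′≢l ∘ sym)) (upd-≡ cw₁ l h′)

  new-border : List ℕ
  new-border = e′ ∷ border ++ h ∷ l ∷ []

  walk : FaceWalk M′ h′ new-border h′
  walk = visit (trans faceStep-h′ cwv-h′)
           (FaceWalk-++ walk-e′-to-h (visit (trans faceStep-h cwv-e′) (reach (trans faceStep-l cwv-l))))

  ⊑grown : h′ ∷ new-border ⊑ grown
  ⊑grown = ⊑-by-weights [] weights
    where
    weights : ∀ f → weight f (h′ ∷ new-border) + 0 ≡ weight f grown
    weights f rewrite weight-++ f border (h ∷ l ∷ []) = rearrange (f h′) (f e′) (weight f border) (f h) (f l)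
      where
      rearrange : ∀ a b c d e → a + (b + (c + (d + (e + 0)))) + 0 ≡ e + (a + (b + (d + c)))
      rearrange = solve-∀

  legs-new : legs M′ new-border ≡ legs M′ border ++ l ∷ []
  legs-new = begin
    legs M′ (e′ ∷ border ++ h ∷ l ∷ [])     ≡⟨ legs-e′∷ (border ++ h ∷ l ∷ []) ⟩
    legs M′ (border ++ h ∷ l ∷ [])          ≡⟨ filter-++ (isLeg? M′) border (h ∷ l ∷ []) ⟩
    legs M′ border ++ legs M′ (h ∷ l ∷ [])  ≡⟨ cong (legs M′ border ++_) (trans (legs-h∷ (l ∷ [])) (legs-l∷ [])) ⟩
    legs M′ border ++ l ∷ []                ∎
    where open ≡-Reasoning

  legVertices-new : legVertices M′ new-border ≡ legVertices M border ++ vert M′ h′ ∷ []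
  legVertices-new = begin
    map (vert M′) (legs M′ new-border)        ≡⟨ cong (map (vert M′)) legs-new ⟩
    map (vert M′) (legs M′ border ++ l ∷ [])  ≡⟨ map-++ (vert M′) (legs M′ border) (l ∷ []) ⟩
    legVertices M′ border ++ vert M′ l ∷ []   ≡⟨ cong₂ (λ xs x → xs ++ x ∷ []) legVertices-border vert-l≡headVertex ⟩
    legVertices M border ++ vert M′ h′ ∷ []   ∎
    where open ≡-Reasoning

invariant-φb : ∀ {M} → Invariant M → Invariant (φb M)
invariant-φb {M} I =
  invariant new-border walk ⊑grown (here refl) (there ∘ there ∘ ∈-++⁺ˡ)
    (subst (All (λ u → Ancestor (φb M) u (headVertex (φb M)))) (sym legVertices-new)
           (new-vertex-below-new-head ∷ old-legs-below-new-head))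
    (subst (Valley (Ancestor (φb M))) (sym legVertices-new) (Valley-∷ old-legs-below-new-head old-legs-valley))
  where
  open Invariant I using (border)
  cw₁ = upd (λ z → z) (nH M) (suc (nH M))
  cw₂ = upd cw₁ (suc (nH M)) (suc (suc (nH M)))
  cwv = upd cw₂ (suc (suc (nH M))) (nH M)
  open Grow I cwv

  cwv-h′ : cwv h′ ≡ l
  cwv-h′ = trans (upd-≢ cw₂ l e′ h′≢l) (upd-≡ cw₁ h′ l)
  cwv-l : cwv l ≡ e′
  cwv-l = upd-≡ cw₂ l e′
  cwv-e′ : cwv e′ ≡ h′
  cwv-e′ = trans (upd-≢ cw₂ l e′ e′≢l) (trans (upd-≢ cw₁ h′ l e′≢h′) (upd-≡ (λ z → z) e′ h′))

  new-border : List ℕ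
  new-border = l ∷ e′ ∷ border ++ h ∷ []

  walk : FaceWalk M′ h′ new-border h′
  walk = visit (trans faceStep-h′ cwv-h′)
           (visit (trans faceStep-l cwv-l) (FaceWalk-++ walk-e′-to-h (reach (trans faceStep-h cwv-e′))))

  ⊑grown : h′ ∷ new-border ⊑ grown
  ⊑grown = ⊑-by-weights [] weights
    where
    weights : ∀ f → weight f (h′ ∷ new-border) + 0 ≡ weight f grown
    weights f rewrite weight-++ f border (h ∷ []) = rearrange (f h′) (f l) (f e′) (weight f border) (f h)
      where
      rearrange : ∀ a b c d e → a + (b + (c + (d + (e + 0)))) + 0 ≡ b + (a + (c + (e + d)))
      rearrange = solve-∀

  legs-new : legs M′ new-border ≡ l ∷ legs M′ border
  legs-new = begin
    legs M′ (l ∷ e′ ∷ border ++ h ∷ [])       ≡⟨ trans (legs-l∷ _) (cong (l List.∷_) (legs-e′∷ _)) ⟩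
    l ∷ legs M′ (border ++ h ∷ [])            ≡⟨ cong (l List.∷_) (filter-++ (isLeg? M′) border (h ∷ [])) ⟩
    l ∷ legs M′ border ++ legs M′ (h ∷ [])    ≡⟨ cong (λ ls → l ∷ legs M′ border ++ ls) (legs-h∷ []) ⟩
    l ∷ legs M′ border ++ []                  ≡⟨ cong (l List.∷_) (++-identityʳ (legs M′ border)) ⟩
    l ∷ legs M′ border                        ∎
    where open ≡-Reasoning

  legVertices-new : legVertices M′ new-border ≡ vert M′ h′ ∷ legVertices M border
  legVertices-new = begin
    map (vert M′) (legs M′ new-border)  ≡⟨ cong (map (vert M′)) legs-new ⟩
    vert M′ l ∷ legVertices M′ border   ≡⟨ cong₂ List._∷_ vert-l≡headVertex legVertices-border ⟩
    vert M′ h′ ∷ legVertices M border   ∎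
    where open ≡-Reasoning

-- φc

module Glue {M : TGMap} (I : Invariant M) (g n : ℕ) (g≢h : g ≢ head M) (n≢h : n ≢ head M) (g≢n : g ≢ n)
            (g-leg : α M g ≡ g) (n-leg : α M n ≡ n) (g<nH : g < nH M) where
  open Invariant I

  h = head M
  M′ = glue M g n

  α-other : ∀ {z} → z ≢ g → z ≢ h → α M′ z ≡ α M z
  α-other z≢g z≢h = trans (upd-≢ (upd (α M) h g) g h z≢g) (upd-≢ (α M) h g z≢h)
  α-g : α M′ g ≡ h
  α-g = upd-≡ (upd (α M) h g) g h
  α-h : α M′ h ≡ g
  α-h = trans (upd-≢ (upd (α M) h g) g h (g≢h ∘ sym)) (upd-≡ (α M) h g)

  faceStep-other : ∀ {z} → z ≢ g × z ≢ h → faceStep M′ z ≡ faceStep M z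
  faceStep-other (z≢g , z≢h) = cong (cw M) (α-other z≢g z≢h)
  faceStep-g : faceStep M′ g ≡ faceStep M h
  faceStep-g = cong (cw M) (trans α-g (sym head-isLeg))
  faceStep-h : faceStep M′ h ≡ faceStep M g
  faceStep-h = cong (cw M) (trans α-h (sym g-leg))

  faceSteps-other : ∀ {xs} → All (λ z → z ≢ g × z ≢ h) xs → All (λ z → faceStep M′ z ≡ faceStep M z) xs
  faceSteps-other = All.map faceStep-other

  legs-other : ∀ {xs} → All (λ z → z ≢ g × z ≢ h) xs → legs M′ xs ≡ legs M xs
  legs-other {xs} = legs-cong {M} {M′} xs ∘ All.map (uncurry α-other)

  legs-h∷ : ∀ zs → legs M′ (h ∷ zs) ≡ legs M′ zs
  legs-h∷ zs = filter-reject (isLeg? M′) {xs = zs} (g≢h ∘ trans (sym α-h))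

  legs-g∷ : ∀ zs → legs M′ (g ∷ zs) ≡ legs M′ zs
  legs-g∷ zs = filter-reject (isLeg? M′) {xs = zs} (g≢h ∘ sym ∘ trans (sym α-g))

  leg-of-glued : ∀ z → α M′ z ≡ z → z ≢ g × z ≢ h × α M z ≡ z
  leg-of-glued z z-leg with z ≟ g | z ≟ h
  ... | yes refl | _        = ⊥-elim (g≢h (sym (trans (sym α-g) z-leg)))
  ... | no _     | yes refl = ⊥-elim (g≢h (trans (sym α-h) z-leg))
  ... | no z≢g   | no z≢h   = z≢g , z≢h , trans (sym (α-other z≢g z≢h)) z-leg

  tree-not-glued : ∀ {z} → inT M z ≡ true → z ≢ g × z ≢ h
  tree-not-glued {z} tree = (λ { refl → proj₂ (tree-halfEdge z tree) g-leg }) , (λ { refl → proj₂ (tree-halfEdge z tree) head-isLeg })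

  α-tree : ∀ {z} → inT M z ≡ true → α M′ z ≡ α M z
  α-tree = uncurry α-other ∘ tree-not-glued

  embedding : TreeEmbedding M M′
  embedding = record
    { same-rootVertex = refl
    ; keeps-edge = λ z tree → tree , proj₁ (tree-halfEdge z tree) , refl , cong (vert M) (α-tree tree) }

  levelling′ : Levelling M′
  levelling′ = record
    { depth = depth ; parent = parent ; depth-root = depth-root
    ; tree-edge = λ z tree → subst (TreeEdge depth parent (vert M z)) (cong (vert M) (sym (α-tree tree))) (tree-edge z tree) }
    where open Levelling levelling

  α-bounded′ : ∀ z → z < nH M → α M′ z < nH M
  α-bounded′ z z< with z ≟ g | z ≟ h
  ... | yes refl | _        = subst (_< nH M) (sym α-g) (All.head border-bounded)
  ... | no _     | yes refl = subst (_< nH M) (sym α-h) g<nH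
  ... | no z≢g   | no z≢h   = subst (_< nH M) (sym (α-other z≢g z≢h)) (α-bounded z z<)

  invariant : (new-border : List ℕ) → FaceWalk M′ n new-border n → n ∷ new-border ⊑ h ∷ border →
              (∀ z → z ∈ border → α M z ≡ z → z ≢ g → z ≢ n → z ∈ new-border) →
              (ls : List ℕ) → legVertices M′ new-border ≡ ls →
              All (λ x → Ancestor M x (vert M g) ⊎ Ancestor M x (vert M n)) ls → Valley (Ancestor M) ls →
              Ancestor M (vert M g) (vert M n) → Invariant M′
  invariant new-border walk ⊑old legs-kept ls legVertices≡ls below-g-or-n valley g≤n = record
    { border             = new-border
    ; border-walk        = walk
    ; border-distinct    = ⊑-Distinct ⊑old border-distinct
    ; border-bounded     = ⊑-All ⊑old border-bounded
    ; border-length      = ≤-trans (⊑-length ⊑old) border-length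
    ; root-bounded       = root-bounded
    ; α-bounded          = α-bounded′
    ; vert-bounded       = vert-bounded
    ; tree-halfEdge      = λ z tree → proj₁ (tree-halfEdge z tree) , subst (_≢ z) (sym (α-tree tree)) (proj₂ (tree-halfEdge z tree))
    ; head-isLeg         = trans (α-other (g≢n ∘ sym) n≢h) n-leg
    ; legs-on-border     = legs-on-border′
    ; levelling          = levelling′
    ; head-path          = proj₁ g≤n , TPath-embed embedding (proj₁ (proj₂ g≤n))
    ; legs-below-head    = subst (All (λ u → Ancestor M′ u (vert M n))) (sym legVertices≡ls) (All.map below-n below-g-or-n)
    ; legVertices-valley = subst (Valley (Ancestor M′)) (sym legVertices≡ls) (Valley-map (Ancestor-embed embedding) valley)
    }
    where
    legs-on-border′ : ∀ z → IsLeg M′ z → z ≢ n → z ∈ new-border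
    legs-on-border′ z (z< , z-leg) z≢n with leg-of-glued z z-leg
    ... | z≢g , z≢h , z-leg-in-M = legs-kept z (legs-on-border z (z< , z-leg-in-M) z≢h) z-leg-in-M z≢g z≢n
    below-n : ∀ {x} → Ancestor M x (vert M g) ⊎ Ancestor M x (vert M n) → Ancestor M′ x (vert M n)
    below-n (inj₁ x≤g) = Ancestor-embed embedding (Ancestor-trans levelling x≤g g≤n)
    below-n (inj₂ x≤n) = Ancestor-embed embedding x≤n

module GlueFirstLast {M : TGMap} (I : Invariant M) {s t : ℕ}
                     (split : FirstLastSplit (isLeg? M) (Invariant.border I) s t) where
  open Invariant I
  open FirstLastSplit split

  h = head M

  distinct : Distinct (h ∷ pre ++ s ∷ mid ++ t ∷ post)
  distinct = subst (λ b → Distinct (h ∷ b)) shape border-distinct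

  h-avoided : All (_≢ h) (pre ++ s ∷ mid ++ t ∷ post)
  h-avoided = subst (All (_≢ h)) shape head∉border

  s-avoided-left : All (_≢ s) (h ∷ pre)
  s-avoided-left = ∉⇒All≢ (proj₁ (Distinct-middle (h ∷ pre) distinct))

  s-avoided-right : All (_≢ s) (mid ++ t ∷ post)
  s-avoided-right = ∉⇒All≢ (proj₂ (Distinct-middle (h ∷ pre) distinct))

  t-avoided : t ∉ h ∷ pre ++ s ∷ mid × t ∉ post
  t-avoided = Distinct-middle (h ∷ pre ++ s ∷ mid)
                (subst Distinct (cong (h List.∷_) (sym (++-assoc pre (s ∷ mid) (t ∷ post)))) distinct)

  t-avoided-left : All (_≢ t) (h ∷ pre ++ s ∷ mid)
  t-avoided-left = ∉⇒All≢ (proj₁ t-avoided)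

  t-avoided-right : All (_≢ t) post
  t-avoided-right = ∉⇒All≢ (proj₂ t-avoided)

  h-avoided-right : All (_≢ h) (s ∷ mid ++ t ∷ post)
  h-avoided-right = All.++⁻ʳ pre h-avoided

  s≢h : s ≢ h
  s≢h = All.head h-avoided-right
  t≢h : t ≢ h
  t≢h = All.head (All.++⁻ʳ mid (All.tail h-avoided-right))
  t≢s : t ≢ s
  t≢s = All.head (All.++⁻ʳ mid s-avoided-right)

  Avoids : List ℕ → Set
  Avoids = All (λ z → z ≢ h × z ≢ s × z ≢ t)

  avoiding : ∀ {xs} → All (_≢ h) xs → All (_≢ s) xs → All (_≢ t) xs → Avoids xs
  avoiding ≢h ≢s ≢t = All.zipWith (λ p → p) (≢h , All.zipWith (λ p → p) (≢s , ≢t))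

  pre-avoids : Avoids pre
  pre-avoids = avoiding (All.++⁻ˡ pre h-avoided) (All.tail s-avoided-left) (All.++⁻ˡ pre (All.tail t-avoided-left))

  mid-avoids : Avoids mid
  mid-avoids = avoiding (All.++⁻ˡ mid (All.tail h-avoided-right)) (All.++⁻ˡ mid s-avoided-right)
                        (All.tail (All.++⁻ʳ pre (All.tail t-avoided-left)))

  post-avoids : Avoids post
  post-avoids = avoiding (All.tail (All.++⁻ʳ mid (All.tail h-avoided-right))) (All.tail (All.++⁻ʳ mid s-avoided-right))
                         t-avoided-right

  walk-at-s : FaceWalk M h pre s × FaceWalk M s (mid ++ t ∷ post) h
  walk-at-s = FaceWalk-split pre (subst (λ b → FaceWalk M h b h) shape border-walk)

  walk-h-s : FaceWalk M h pre s
  walk-h-s = proj₁ walk-at-s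

  walk-s-t : FaceWalk M s mid t
  walk-s-t = proj₁ (FaceWalk-split mid (proj₂ walk-at-s))

  walk-t-h : FaceWalk M t post h
  walk-t-h = proj₂ (FaceWalk-split mid (proj₂ walk-at-s))

  bounded : All (_< nH M) (h ∷ pre ++ s ∷ mid ++ t ∷ post)
  bounded = subst (λ b → All (_< nH M) (h ∷ b)) shape border-bounded

  s<nH : s < nH M
  s<nH = All.lookup bounded (there (∈-++⁺ʳ pre (here refl)))

  t<nH : t < nH M
  t<nH = All.lookup bounded (there (∈-++⁺ʳ pre (there (∈-++⁺ʳ mid (here refl)))))

  legs-none : ∀ {xs} → All (∁ (λ z → α M z ≡ z)) xs → legs M xs ≡ []
  legs-none = filter-none (isLeg? M)

  legs-border : legs M border ≡ s ∷ legs M mid ++ t ∷ []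
  legs-border = begin
    legs M border                               ≡⟨ cong (legs M) shape ⟩
    legs M (pre ++ s ∷ mid ++ t ∷ post)         ≡⟨ filter-++ (isLeg? M) pre _ ⟩
    legs M pre ++ legs M (s ∷ mid ++ t ∷ post)  ≡⟨ cong (_++ legs M (s ∷ mid ++ t ∷ post)) (legs-none pre-none) ⟩
    legs M (s ∷ mid ++ t ∷ post)                ≡⟨ filter-accept (isLeg? M) {xs = mid ++ t ∷ post} first ⟩
    s ∷ legs M (mid ++ t ∷ post)                ≡⟨ cong (s List.∷_) (filter-++ (isLeg? M) mid _) ⟩
    s ∷ legs M mid ++ legs M (t ∷ post)         ≡⟨ cong (λ ls → s ∷ legs M mid ++ ls) (filter-accept (isLeg? M) {xs = post} final) ⟩
    s ∷ legs M mid ++ t ∷ legs M post           ≡⟨ cong (λ ls → s ∷ legs M mid ++ t ∷ ls) (legs-none post-none) ⟩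
    s ∷ legs M mid ++ t ∷ []                    ∎
    where open ≡-Reasoning

  legVertices-border : legVertices M border ≡ vert M s ∷ legVertices M mid ++ vert M t ∷ []
  legVertices-border = trans (cong (map (vert M)) legs-border) (cong (vert M s List.∷_) (map-++ (vert M) (legs M mid) (t ∷ [])))

  mid-valley : Valley (Ancestor M) (legVertices M mid)
  mid-valley = Valley-inner (subst (Valley (Ancestor M)) legVertices-border legVertices-valley)

  mid-below-s-or-t : All (λ x → Ancestor M x (vert M s) ⊎ Ancestor M x (vert M t)) (legVertices M mid)
  mid-below-s-or-t = Valley-between (subst (Valley (Ancestor M)) legVertices-border legVertices-valley)

  leg-in-mid : ∀ z → z ∈ border → α M z ≡ z → z ≢ s → z ≢ t → z ∈ mid
  leg-in-mid z z∈border z-leg z≢s z≢t with ∈-++⁻ pre (subst (z ∈_) shape z∈border)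
  ... | inj₁ z∈pre = ⊥-elim (All.lookup pre-none z∈pre z-leg)
  ... | inj₂ (here refl) = ⊥-elim (z≢s refl)
  ... | inj₂ (there z∈rest) with ∈-++⁻ mid z∈rest
  ...   | inj₁ z∈mid = z∈mid
  ...   | inj₂ (here refl) = ⊥-elim (z≢t refl)
  ...   | inj₂ (there z∈post) = ⊥-elim (All.lookup post-none z∈post z-leg)

  invariant-first : Ancestor M (vert M s) (vert M t) → Invariant (glue M s t)
  invariant-first = invariant (post ++ h ∷ mid) walk ⊑old legs-kept (legVertices M mid) legVertices-new mid-below-s-or-t mid-valley
    where
    open Glue I s t s≢h t≢h (t≢s ∘ sym) first final s<nH using (M′; invariant; faceStep-other; faceStep-h; faceSteps-other; legs-other; legs-h∷)

    avoid : ∀ {xs} → Avoids xs → All (λ z → z ≢ s × z ≢ h) xs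
    avoid = All.map λ { (≢h , ≢s , _) → ≢s , ≢h }

    walk : FaceWalk M′ t (post ++ h ∷ mid) t
    walk = FaceWalk-++ (FaceWalk-transport (faceStep-other (t≢s , t≢h)) (faceSteps-other (avoid post-avoids)) walk-t-h)
                       (FaceWalk-transport faceStep-h (faceSteps-other (avoid mid-avoids)) walk-s-t)

    weights : ∀ f → weight f (t ∷ post ++ h ∷ mid) + weight f (s ∷ pre) ≡ weight f (h ∷ pre ++ s ∷ mid ++ t ∷ post)
    weights f rewrite weight-++ f post (h ∷ mid) | weight-++ f pre (s ∷ mid ++ t ∷ post) | weight-++ f mid (t ∷ post) =
      rearrange (f t) (weight f post) (f h) (weight f mid) (f s) (weight f pre)
      where
      rearrange : ∀ a b c d e g → a + (b + (c + d)) + (e + g) ≡ c + (g + (e + (d + (a + b))))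
      rearrange = solve-∀

    ⊑old : t ∷ post ++ h ∷ mid ⊑ h ∷ border
    ⊑old = subst (λ b → t ∷ post ++ h ∷ mid ⊑ h ∷ b) (sym shape) (⊑-by-weights (s ∷ pre) weights)

    legs-kept : ∀ z → z ∈ border → α M z ≡ z → z ≢ s → z ≢ t → z ∈ post ++ h ∷ mid
    legs-kept z z∈border z-leg z≢s z≢t = ∈-++⁺ʳ post (there (leg-in-mid z z∈border z-leg z≢s z≢t))

    legVertices-new : legVertices M′ (post ++ h ∷ mid) ≡ legVertices M mid
    legVertices-new = cong (map (vert M)) (begin
      legs M′ (post ++ h ∷ mid)          ≡⟨ filter-++ (isLeg? M′) post (h ∷ mid) ⟩
      legs M′ post ++ legs M′ (h ∷ mid)  ≡⟨ cong₂ _++_ (trans (legs-other (avoid post-avoids)) (legs-none post-none))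
                                                       (trans (legs-h∷ mid) (legs-other (avoid mid-avoids))) ⟩
      legs M mid                         ∎)
      where open ≡-Reasoning

  invariant-last : Ancestor M (vert M t) (vert M s) → Invariant (glue M t s)
  invariant-last = invariant (mid ++ t ∷ pre) walk ⊑old legs-kept (legVertices M mid) legVertices-new
                             (All.map swap mid-below-s-or-t) mid-valley
    where
    open Glue I t s t≢h s≢h t≢s final first t<nH using (M′; invariant; faceStep-other; faceStep-g; faceSteps-other; legs-other; legs-g∷)

    avoid : ∀ {xs} → Avoids xs → All (λ z → z ≢ t × z ≢ h) xs
    avoid = All.map λ { (≢h , _ , ≢t) → ≢t , ≢h }

    walk : FaceWalk M′ s (mid ++ t ∷ pre) s
    walk = FaceWalk-++ (FaceWalk-transport (faceStep-other (t≢s ∘ sym , s≢h)) (faceSteps-other (avoid mid-avoids)) walk-s-t)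
                       (FaceWalk-transport faceStep-g (faceSteps-other (avoid pre-avoids)) walk-h-s)

    weights : ∀ f → weight f (s ∷ mid ++ t ∷ pre) + weight f (h ∷ post) ≡ weight f (h ∷ pre ++ s ∷ mid ++ t ∷ post)
    weights f rewrite weight-++ f mid (t ∷ pre) | weight-++ f pre (s ∷ mid ++ t ∷ post) | weight-++ f mid (t ∷ post) =
      rearrange (f s) (weight f mid) (f t) (weight f pre) (f h) (weight f post)
      where
      rearrange : ∀ a b c d e g → a + (b + (c + d)) + (e + g) ≡ e + (d + (a + (b + (c + g))))
      rearrange = solve-∀

    ⊑old : s ∷ mid ++ t ∷ pre ⊑ h ∷ border
    ⊑old = subst (λ b → s ∷ mid ++ t ∷ pre ⊑ h ∷ b) (sym shape) (⊑-by-weights (h ∷ post) weights)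

    legs-kept : ∀ z → z ∈ border → α M z ≡ z → z ≢ t → z ≢ s → z ∈ mid ++ t ∷ pre
    legs-kept z z∈border z-leg z≢t z≢s = ∈-++⁺ˡ (leg-in-mid z z∈border z-leg z≢s z≢t)

    legVertices-new : legVertices M′ (mid ++ t ∷ pre) ≡ legVertices M mid
    legVertices-new = cong (map (vert M)) (begin
      legs M′ (mid ++ t ∷ pre)           ≡⟨ filter-++ (isLeg? M′) mid (t ∷ pre) ⟩
      legs M′ mid ++ legs M′ (t ∷ pre)   ≡⟨ cong₂ _++_ (legs-other (avoid mid-avoids))
                                                       (trans (legs-g∷ pre) (trans (legs-other (avoid pre-avoids)) (legs-none pre-none))) ⟩
      legs M mid ++ []                   ≡⟨ ++-identityʳ (legs M mid) ⟩
      legs M mid                         ∎)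
      where open ≡-Reasoning

first-last-split-border : ∀ {M} (I : Invariant M) {s t} → firstLeg M ≡ just s → lastLeg M ≡ just t → vert M s ≢ vert M t →
                          FirstLastSplit (isLeg? M) (Invariant.border I) s t
first-last-split-border {M} I {s} {t} first final vs≢vt =
  first-last-split (isLeg? M) (Invariant.border I)
    (subst (λ ls → List.head ls ≡ just s) (Invariant.tour≡legs I) first)
    (subst (λ ls → last ls ≡ just t) (Invariant.tour≡legs I) final)
    (vs≢vt ∘ cong (vert M))

invariant-step : ∀ {x M M′} → Invariant M → Step x M M′ → Invariant M′
invariant-step I (stepA M) = invariant-φa I
invariant-step I (stepB M) = invariant-φb I
invariant-step I (stepC₁ M s t first final vs≢vt s≤t) =
  GlueFirstLast.invariant-first I (first-last-split-border I first final vs≢vt) s≤t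
invariant-step I (stepC₂ M s t first final vs≢vt t≤s) =
  GlueFirstLast.invariant-last I (first-last-split-border I first final vs≢vt) t≤s

invariant-Phi : ∀ {w M} → Phi w M → Invariant M
invariant-Phi nil              = invariant-M0
invariant-Phi (cons φw x-step) = invariant-step (invariant-Phi φw) x-step

mainTheorem5 : (w : List Letter) (M : TGMap) → Phi w M →
    (h : ℕ) → IsLeg M h → Ancestor M (vert M h) (headVertex M)
mainTheorem5 w M φw = Invariant.leg-below-head (invariant-Phi φw)
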